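{- Let $p:\mathbb E\to\mathbb B$ be a posetal fibration with fibred small limits and $\mathcal T$ a monad on $\mathbb B$. For any $X\in\mathbb E$: $q_X\circ[-]^{pX}=\mathrm{id}_{\mathbf{Cls}(\mathcal T,X)}$, and for every $\dot{\mathcal T}\in\mathbf{Lift}(\mathcal T)$ we have $\dot T\preceq[\dot TX]^{pX}$ (i.e. $\mathrm{id}_{\mathbf{Lift}(\mathcal T)}\preceq[-]^{pX}\circ q_X$).
   Context: $p$ posetal: fibres are posets; $p$ faithful, and $\mathbb E(X,Y)\subseteq\mathbb B(pX,pY)$. Fibres have arbitrary meets $\bigwedge$. $\mathcal T=(T,\eta,\mu)$, $f^\#=\mu\circ Tf$. $\mathbf{Lift}(\mathcal T)$ is the class of liftings of $\mathcal T$ along $p$ (monads $\dot{\mathcal T}$ on $\mathbb E$ with $p\dot T=Tp$, $p\dot\eta=\eta p$, $p\dot\mu=\mu p$), ordered by $\dot T\preceq\dot T'$ iff $\dot TX\le\dot T'X$ in $\mathbb E_{T(pX)}$ for all $X$. For $R\in\mathbb B$, $S\in\mathbb E_{TR}$, $[S]^R\in\mathbf{Lift}(\mathcal T)$ is the (pointwise) codensity lifting with single parameter $(R,S)$, with object part $[S]^RY=\bigwedge_{f\in\mathbb E(Y,S)}(f^\#)^{ -1}(S)$. $\mathbf{Cls}(\mathcal T,X)=\{S\in\mathbb E_{T(pX)}\mid S=[S]^{pX}X\}$ with order inherited from the fibre; $[-]^{pX}$ is regarded as a function $\mathbf{Cls}(\mathcal T,X)\to\mathbf{Lift}(\mathcal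 T)$; $q_X:\mathbf{Lift}(\mathcal T)\to\mathbf{Cls}(\mathcal T,X)$, $q_X(\dot T)=\dot TX$. -}

module Defs where

open import Level using (Level; _⊔_) renaming (suc to lsuc)
open import Relation.Binary.PropositionalEquality using (_≡_)
open import Relation.Binary.Bundles using (Poset)
open import Data.Product using (Σ; _,_)

record Category (o h : Level) : Set (lsuc (o ⊔ h)) where
  infixr 9 _∘_
  field
    Obj : Set o
    Hom : Obj → Obj → Set h
    id  : ∀ {A} → Hom A A
    _∘_ : ∀ {A B C} → Hom B C → Hom A B → Hom A C
    identityˡ : ∀ {A B} {f : Hom A B} → id ∘ f ≡ f
    identityʳ : ∀ {A B} {f : Hom A B} → f ∘ id ≡ f
    assoc : ∀ {A B C D} {f : Hom A B} {g : Hom B C} {k : Hom C D} →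
            (k ∘ g) ∘ f ≡ k ∘ (g ∘ f)

record Monad {o h : Level} (C : Category o h) : Set (o ⊔ h) where
  open Category C
  field
    T₀ : Obj → Obj
    T₁ : ∀ {A B} → Hom A B → Hom (T₀ A) (T₀ B)
    T-id : ∀ {A} → T₁ (id {A}) ≡ id
    T-∘ : ∀ {A B C} {f : Hom A B} {g : Hom B C} → T₁ (g ∘ f) ≡ T₁ g ∘ T₁ f
    η : ∀ A → Hom A (T₀ A)
    μ : ∀ A → Hom (T₀ (T₀ A)) (T₀ A)
    η-nat : ∀ {A B} {f : Hom A B} → η B ∘ f ≡ T₁ f ∘ η A
    μ-nat : ∀ {A B} {f : Hom A B} → μ B ∘ T₁ (T₁ f) ≡ T₁ f ∘ μ A
    unitˡ : ∀ {A} → μ A ∘ T₁ (η A) ≡ id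
    unitʳ : ∀ {A} → μ A ∘ η (T₀ A) ≡ id
    μ-assoc : ∀ {A} → μ A ∘ T₁ (μ A) ≡ μ A ∘ μ (T₀ A)

  _^# : ∀ {A B} → Hom A (T₀ B) → Hom (T₀ A) (T₀ B)
  _^# {B = B} f = μ B ∘ T₁ f

-- A posetal fibration p : 𝔼 → 𝔹, presented (equivalently, via the
-- Grothendieck construction) by its fibres 𝔼_I (posets) and reindexing
-- f⁻¹ : 𝔼_J → 𝔼_I.  An object of 𝔼 over I is an element of the fibre
-- 𝔼_I, and 𝔼((I,X),(J,Y)) = { f ∈ 𝔹(I,J) | X ≤ f⁻¹ Y } ⊆ 𝔹(I,J).
record PosetalFibration {o h : Level} (C : Category o h) (c ℓ₁ ℓ₂ : Level)
       : Set (o ⊔ lsuc (h ⊔ c ⊔ ℓ₁ ⊔ ℓ₂)) where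
  open Category C
  field
    Fib : Obj → Poset c ℓ₁ ℓ₂

  ∣_∣ : Obj → Set c
  ∣ I ∣ = Poset.Carrier (Fib I)

  _⊑_ : ∀ {I} → ∣ I ∣ → ∣ I ∣ → Set ℓ₂
  _⊑_ {I} = Poset._≤_ (Fib I)

  _≈_ : ∀ {I} → ∣ I ∣ → ∣ I ∣ → Set ℓ₁
  _≈_ {I} = Poset._≈_ (Fib I)

  field
    _⁻¹ : ∀ {I J} → Hom I J → ∣ J ∣ → ∣ I ∣
    reindex-mono : ∀ {I J} (f : Hom I J) {x y : ∣ J ∣} → x ⊑ y → (f ⁻¹) x ⊑ (f ⁻¹) y
    reindex-id : ∀ {I} (x : ∣ I ∣) → (id ⁻¹) x ≈ x
    reindex-∘ : ∀ {I J K} (f : Hom I J) (g : Hom J K) (x : ∣ K ∣) →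
                ((g ∘ f) ⁻¹) x ≈ (f ⁻¹) ((g ⁻¹) x)

  EHom : ∀ {I J} → ∣ I ∣ → ∣ J ∣ → Set (h ⊔ ℓ₂)
  EHom {I} {J} X Y = Σ (Hom I J) (λ f → X ⊑ (f ⁻¹) Y)

-- Fibred small limits for a posetal fibration: every fibre has meets of
-- all small families (indexed by types of size h ⊔ ℓ₂, the size of the
-- hom-sets of 𝔼), and reindexing preserves them.
record FibredMeets {o h c ℓ₁ ℓ₂ : Level} {C : Category o h}
       (P : PosetalFibration C c ℓ₁ ℓ₂) : Set (o ⊔ lsuc (h ⊔ c ⊔ ℓ₁ ⊔ ℓ₂)) where
  open Category C
  open PosetalFibration P
  field
    ⋀ : ∀ {I} {A : Set (h ⊔ ℓ₂)} → (A → ∣ I ∣) → ∣ I ∣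
    ⋀-lower : ∀ {I} {A : Set (h ⊔ ℓ₂)} (F : A → ∣ I ∣) (a : A) → ⋀ F ⊑ F a
    ⋀-greatest : ∀ {I} {A : Set (h ⊔ ℓ₂)} (F : A → ∣ I ∣) (x : ∣ I ∣) →
                 (∀ a → x ⊑ F a) → x ⊑ ⋀ F
    reindex-⋀ : ∀ {I J} (f : Hom I J) {A : Set (h ⊔ ℓ₂)} (F : A → ∣ J ∣) →
                (f ⁻¹) (⋀ F) ≈ ⋀ (λ a → (f ⁻¹) (F a))

module _ {o h c ℓ₁ ℓ₂ : Level} {C : Category o h} (M : Monad C)
         (P : PosetalFibration C c ℓ₁ ℓ₂) where
  open Category C
  open Monad M
  open PosetalFibration P

  -- A lifting of the monad along the posetal (hence faithful) fibration p.
  -- Since p is faithful and fibres are posets, a lifting is determined by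
  -- its object part Ṫ (with p Ṫ = T p), subject to: T f is a morphism
  -- Ṫ X → Ṫ Y whenever f : X → Y, η_{pX} is a morphism X → Ṫ X, and
  -- μ_{pX} is a morphism Ṫ Ṫ X → Ṫ X.  (Functor/monad laws and p Ṫη = ηp,
  -- p Ṫμ = μp are then automatic.)
  record Lifting : Set (o ⊔ h ⊔ c ⊔ ℓ₂) where
    field
      Ṫ : ∀ {I} → ∣ I ∣ → ∣ T₀ I ∣
      Ṫ-hom : ∀ {I J} {X : ∣ I ∣} {Y : ∣ J ∣} (f : Hom I J) →
              X ⊑ (f ⁻¹) Y → Ṫ X ⊑ (T₁ f ⁻¹) (Ṫ Y)
      η̇ : ∀ {I} (X : ∣ I ∣) → X ⊑ (η I ⁻¹) (Ṫ X)
      μ̇ : ∀ {I} (X : ∣ I ∣) → Ṫ (Ṫ X) ⊑ (μ I ⁻¹) (Ṫ X)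
  open Lifting public

  _⪯_ : Lifting → Lifting → Set (o ⊔ c ⊔ ℓ₂)
  L ⪯ L' = ∀ {I} (X : ∣ I ∣) → Ṫ L X ⊑ Ṫ L' X

  module _ (Mt : FibredMeets P) where
    open FibredMeets Mt

    codensity : (R : Obj) → ∣ T₀ R ∣ → ∀ {I} → ∣ I ∣ → ∣ T₀ I ∣
    codensity R S {I} Y = ⋀ {A = EHom Y S} (λ { (f , _) → ((f ^#) ⁻¹) S })

    IsCls : ∀ {I} → ∣ I ∣ → ∣ T₀ I ∣ → Set ℓ₁
    IsCls {I} X S = S ≈ codensity I S X

-- The codensity lifting [S]^R is the largest lifting for which S carries an
-- algebra structure, i.e. μ_R : Ṫ S → S is a morphism of 𝔼.  Every lifting Ṫ
-- makes Ṫ X such an algebra (by μ̇), which gives Ṫ ⪯ [Ṫ X]^{pX}; conversely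
-- η_{pX} : X → Ṫ X is one of the morphisms in the meet defining [Ṫ X]^{pX} X,
-- and η^# = id, so [Ṫ X]^{pX} X ≤ Ṫ X.  The first claim is the definition of
-- Cls read backwards.
module Submission where

open import Defs
open import Level using (Level)
open import Data.Product using (_×_; _,_)
open import Relation.Binary.PropositionalEquality using (subst) renaming (sym to ≡-sym)
open import Relation.Binary.Bundles using (Poset)

module CodensityLifting {o h c ℓ₁ ℓ₂ : Level} {C : Category o h} (M : Monad C)
       (P : PosetalFibration C c ℓ₁ ℓ₂) (Mt : FibredMeets P) where

  open Category C
  open Monad M
  open PosetalFibration P
  open FibredMeets Mt
  private module Fib (K : Obj) = Poset (Fib K)

  codensity-lower : ∀ {R I} (S : ∣ T₀ R ∣) {Y : ∣ I ∣} (f : Hom I (T₀ R)) →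
                    Y ⊑ (f ⁻¹) S → codensity M P Mt R S Y ⊑ ((f ^#) ⁻¹) S
  codensity-lower S f Y⊑f⁻¹S = ⋀-lower _ (f , Y⊑f⁻¹S)

  codensity-unit-⊑ : ∀ {R} (S : ∣ T₀ R ∣) {Z : ∣ R ∣} →
                     Z ⊑ (η R ⁻¹) S → codensity M P Mt R S Z ⊑ S
  codensity-unit-⊑ {R} S Z⊑η⁻¹S =
    Fib.trans (T₀ R) (codensity-lower S (η R) Z⊑η⁻¹S) η^#⁻¹S⊑S
    where
    η^#⁻¹S⊑S : ((η R ^#) ⁻¹) S ⊑ S
    η^#⁻¹S⊑S = subst (λ g → (g ⁻¹) S ⊑ S) (≡-sym unitˡ)
                     (Fib.reflexive (T₀ R) (reindex-id S))

  lifting-⊑-codensity : (L : Lifting M P) {R : Obj} (S : ∣ T₀ R ∣) →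
                        Ṫ L S ⊑ (μ R ⁻¹) S →
                        ∀ {J} (Y : ∣ J ∣) → Ṫ L Y ⊑ codensity M P Mt R S Y
  lifting-⊑-codensity L {R} S algebra {J} Y = ⋀-greatest _ (Ṫ L Y) bound
    where
    bound : ((f , Y⊑f⁻¹S) : EHom Y S) → Ṫ L Y ⊑ ((f ^#) ⁻¹) S
    bound (f , Y⊑f⁻¹S) = Fib.trans (T₀ J) (Ṫ-hom L f Y⊑f⁻¹S)
      (Fib.trans (T₀ J) (reindex-mono (T₁ f) algebra)
        (Fib.reflexive (T₀ J) (Fib.Eq.sym (T₀ J) (reindex-∘ (T₁ f) (μ R) S))))

  lifting-⊑-codensity-at : (L : Lifting M P) {I : Obj} (X : ∣ I ∣) →
                           ∀ {J} (Y : ∣ J ∣) → Ṫ L Y ⊑ codensity M P Mt I (Ṫ L X) Y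
  lifting-⊑-codensity-at L X = lifting-⊑-codensity L (Ṫ L X) (μ̇ L X)

  lifting-isCls : (L : Lifting M P) {I : Obj} (X : ∣ I ∣) → IsCls M P Mt X (Ṫ L X)
  lifting-isCls L {I} X = Fib.antisym (T₀ I) (lifting-⊑-codensity-at L X X)
                                             (codensity-unit-⊑ (Ṫ L X) (η̇ L X))

theorem8p5 : ∀ {o h c ℓ₁ ℓ₂ : Level} (C : Category o h) (M : Monad C)
    (P : PosetalFibration C c ℓ₁ ℓ₂) (Mt : FibredMeets P)
    {I : Category.Obj C} (X : PosetalFibration.∣_∣ P I) →
    (∀ (S : PosetalFibration.∣_∣ P (Monad.T₀ M I)) → IsCls M P Mt X S →
      PosetalFibration._≈_ P (codensity M P Mt I S X) S)
    × (∀ (L : Lifting M P) →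
        IsCls M P Mt X (Ṫ L X)
        × (∀ {J : Category.Obj C} (Y : PosetalFibration.∣_∣ P J) →
            PosetalFibration._⊑_ P (Ṫ L Y) (codensity M P Mt I (Ṫ L X) Y)))
theorem8p5 C M P Mt {I} X =
  (λ S S≈[S]X → Poset.Eq.sym (PosetalFibration.Fib P (Monad.T₀ M I)) S≈[S]X) ,
  λ L → lifting-isCls L X , lifting-⊑-codensity-at L X
  where open CodensityLifting M P Mt
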